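{- Let $H$ be a finite group and $k\ge 2$ an integer. Pick $u_i^0,u_i^1\in H$ for $i\in\{0,1,\dots,k-1\}$ independently and uniformly at random, and define the random vector $s\in H^{2^k}$, with coordinates indexed by $x\in\{0,1\}^k$, by $s(x)=u_0^{x_0}u_1^{x_1}\cdots u_{k-1}^{x_{k-1}}$. Then the distribution of $s$ over $H^{2^k}$ is $3$-uniform.
   Context: A distribution over $H^t$ is $3$-uniform if for any $3$ distinct coordinates, the induced marginal distribution on those coordinates is exactly uniform over $H^3$. Here $u_i^{0},u_i^{1}$ are two independent group elements (superscripts are labels, not powers). -}

module Defs where

open import Data.Nat using (ℕ; zero; suc; _*_; _^_)
open import Data.Fin using (Fin; zero; suc; _≟_)
open import Data.Bool using (Bool; true; false; if_then_else_)
open import Data.Vec using (Vec; lookup)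
open import Data.List using (List; []; _∷_; [_]; map; concatMap; length; filter; allFin)
open import Data.Product using (_×_; _,_; proj₁; proj₂)
open import Relation.Nullary using (¬_)
open import Relation.Nullary.Decidable using (_×-dec_)
open import Relation.Binary.PropositionalEquality using (_≡_)
open import Algebra.Structures using (IsGroup)

-- A finite group: a group structure (with propositional equality) on Fin order.
-- Every finite group is isomorphic to one of this form.
record FiniteGroup : Set where
  field
    order : ℕ
    _∙_   : Fin order → Fin order → Fin order
    ε     : Fin order
    _⁻¹   : Fin order → Fin order
    isGroup : IsGroup _≡_ _∙_ ε _⁻¹

cons : ∀ {A : Set} {m : ℕ} → A → (Fin m → A) → (Fin (suc m) → A)
cons a f zero    = a
cons a f (suc i) = f i

allFuns : ∀ {A : Set} → List A → (m : ℕ) → List (Fin m → A)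
allFuns as zero    = [ (λ ()) ]
allFuns as (suc m) = concatMap (λ a → map (cons a) (allFuns as m)) as

-- A distribution over H^T (H = Fin n) given as the pushforward of the uniform
-- distribution on a finite sample space Ω (a list, counted with multiplicity)
-- under s. It is 3-uniform if for any 3 distinct coordinates t₁ t₂ t₃ and any
-- a b c ∈ H, Pr[s(t₁)=a, s(t₂)=b, s(t₃)=c] = 1/n^3, i.e.
-- #{ω | ...} * n^3 = |Ω|.
ThreeUniform : ∀ {S T : Set} (n : ℕ) → List S → (S → T → Fin n) → Set
ThreeUniform {S} {T} n Ω s =
  (t₁ t₂ t₃ : T) → ¬ t₁ ≡ t₂ → ¬ t₁ ≡ t₃ → ¬ t₂ ≡ t₃ →
  (a b c : Fin n) →
  length (filter (λ ω → (s ω t₁ ≟ a) ×-dec ((s ω t₂ ≟ b) ×-dec (s ω t₃ ≟ c))) Ω) * n ^ 3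
    ≡ length Ω

module _ (H : FiniteGroup) where
  open FiniteGroup H

  prod : (k : ℕ) → (Fin k → Fin order) → Fin order
  prod zero    g = ε
  prod (suc k) g = g zero ∙ prod k (λ i → g (suc i))

  -- sample space: u i = (u_i^0 , u_i^1), all choices of (u_i^0,u_i^1)_{i<k}, each once
  sampleSpace : (k : ℕ) → List (Fin k → Fin order × Fin order)
  sampleSpace k = allFuns (concatMap (λ a → map (a ,_) (allFin order)) (allFin order)) k

  pick : Fin order × Fin order → Bool → Fin order
  pick p false = proj₁ p
  pick p true  = proj₂ p

  sVec : (k : ℕ) → (Fin k → Fin order × Fin order) → Vec Bool k → Fin order
  sVec k u x = prod k (λ i → pick (u i) (lookup x i))

{-# OPTIONS --safe #-}
-- Write s(b ∷ x) = u₀ᵇ · s′(x), with s′ built from the remaining k − 1 pairs.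
-- Left multiplication by u₀ᵇ permutes H, so when three distinct coordinates have
-- distinct tails, each choice of (u₀⁰, u₀¹) leaves a count of the same shape in
-- dimension k − 1. When two tails coincide the heads differ, so these coordinates
-- are translated by the independent elements u₀⁰ and u₀¹; the one that the third
-- coordinate does not use absorbs its constraint, leaving a count for two
-- coordinates, which is uniform by the same induction.
module Submission where

open import Defs
open import Data.Nat using (ℕ; suc; _≥_; _+_; _*_; _^_)
open import Data.Nat.Properties
  using ( *-comm; *-identityˡ; *-identityʳ; *-distribˡ-+; *-zeroʳ; +-assoc
        ; +-commutativeSemigroup; *-commutativeSemigroup)
open import Data.Fin using (Fin; zero; suc; _≟_)
open import Data.Bool using (Bool; true; false; if_then_else_)
open import Data.Bool.Properties using (¬-not) renaming (_≟_ to _≟ᵇ_)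
open import Data.Vec using (Vec; []; _∷_)
open import Data.Vec.Properties using (≡-dec)
open import Data.List using (List; []; _∷_; _++_; map; concatMap; length; filter; allFin)
open import Data.List.Properties using (map-tabulate; length-tabulate)
open import Data.Product using (_×_; _,_)
open import Function using (id; _∘_)
open import Relation.Nullary using (Dec; yes; no; does; contradiction)
open import Relation.Nullary.Decidable using (_×-dec_)
open import Relation.Binary.Definitions using (DecidableEquality)
open import Relation.Binary.PropositionalEquality
  using (_≡_; _≢_; refl; sym; trans; cong; cong₂; ≢-sym; module ≡-Reasoning)
open import Algebra.Bundles using (Group)
open import Algebra.Structures using (IsGroup)
import Algebra.Properties.Group as GroupProperties
open import Algebra.Properties.CommutativeSemigroup +-commutativeSemigroup
  using () renaming (interchange to +-interchange)
open import Algebra.Properties.CommutativeSemigroup *-commutativeSemigroup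
  using () renaming (x∙yz≈y∙xz to *-leftComm)
open import Data.Nat.Solver using (module +-*-Solver)
open +-*-Solver using (solve; _:*_; _:^_; _:=_)

open ≡-Reasoning

_≟ᵛ_ : ∀ {k} → DecidableEquality (Vec Bool k)
_≟ᵛ_ = ≡-dec _≟ᵇ_

≢-≢⇒≡ : ∀ {x y z : Bool} → y ≢ x → z ≢ x → z ≡ y
≢-≢⇒≡ y≢x z≢x = trans (¬-not z≢x) (sym (¬-not y≢x))

[_] : ∀ {p} {P : Set p} → Dec P → ℕ
[ d ] = if does d then 1 else 0

[×-dec] : ∀ {p q} {P : Set p} {Q : Set q} (d : Dec P) (e : Dec Q) → [ d ×-dec e ] ≡ [ d ] * [ e ]
[×-dec] d e with does d | does e
... | true  | true  = refl
... | true  | false = refl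
... | false | _     = refl

[]-cong : ∀ {p q} {P : Set p} {Q : Set q} {d : Dec P} {e : Dec Q} →
          (P → Q) → (Q → P) → [ d ] ≡ [ e ]
[]-cong {d = yes p} {yes q} _ _ = refl
[]-cong {d = yes p} {no ¬q} f _ = contradiction (f p) ¬q
[]-cong {d = no ¬p} {yes q} _ g = contradiction (g q) ¬p
[]-cong {d = no ¬p} {no ¬q} _ _ = refl

module _ {A : Set} where

  ∑ : List A → (A → ℕ) → ℕ
  ∑ []       f = 0
  ∑ (x ∷ xs) f = f x + ∑ xs f

  syntax ∑ xs (λ x → e) = ∑[ x ∈ xs ] e

  ∑-cong : ∀ xs {f g : A → ℕ} → (∀ x → f x ≡ g x) → ∑ xs f ≡ ∑ xs g
  ∑-cong []       f≗g = refl
  ∑-cong (x ∷ xs) f≗g = cong₂ _+_ (f≗g x) (∑-cong xs f≗g)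

  ∑-++ : ∀ xs ys (f : A → ℕ) → ∑ (xs ++ ys) f ≡ ∑ xs f + ∑ ys f
  ∑-++ []       ys f = refl
  ∑-++ (x ∷ xs) ys f = trans (cong (f x +_) (∑-++ xs ys f)) (sym (+-assoc (f x) _ _))

  ∑-+ : ∀ xs (f g : A → ℕ) → ∑[ x ∈ xs ] (f x + g x) ≡ ∑ xs f + ∑ xs g
  ∑-+ []       f g = refl
  ∑-+ (x ∷ xs) f g = trans (cong (f x + g x +_) (∑-+ xs f g)) (+-interchange (f x) (g x) _ _)

  ∑-*ˡ : ∀ xs m (f : A → ℕ) → ∑[ x ∈ xs ] (m * f x) ≡ m * ∑ xs f
  ∑-*ˡ []       m f = sym (*-zeroʳ m)
  ∑-*ˡ (x ∷ xs) m f = trans (cong (m * f x +_) (∑-*ˡ xs m f)) (sym (*-distribˡ-+ m (f x) _))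

  ∑-*ʳ : ∀ xs m (f : A → ℕ) → ∑[ x ∈ xs ] (f x * m) ≡ ∑ xs f * m
  ∑-*ʳ xs m f = begin
    ∑[ x ∈ xs ] (f x * m) ≡⟨ ∑-cong xs (λ x → *-comm (f x) m) ⟩
    ∑[ x ∈ xs ] (m * f x) ≡⟨ ∑-*ˡ xs m f ⟩
    m * ∑ xs f            ≡⟨ *-comm m _ ⟩
    ∑ xs f * m            ∎

  ∑-const : ∀ xs m → ∑[ _ ∈ xs ] m ≡ length xs * m
  ∑-const []       m = refl
  ∑-const (x ∷ xs) m = cong (m +_) (∑-const xs m)

  ∑-zero : ∀ xs → ∑[ _ ∈ xs ] 0 ≡ 0
  ∑-zero xs = trans (∑-const xs 0) (*-zeroʳ (length xs))

  length≡∑1 : ∀ xs → length xs ≡ ∑[ _ ∈ xs ] 1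
  length≡∑1 []       = refl
  length≡∑1 (x ∷ xs) = cong (1 +_) (length≡∑1 xs)

  length-filter≡∑ : ∀ {p} {P : A → Set p} (P? : ∀ x → Dec (P x)) xs →
                    length (filter P? xs) ≡ ∑[ x ∈ xs ] [ P? x ]
  length-filter≡∑ P? []       = refl
  length-filter≡∑ P? (x ∷ xs) with does (P? x)
  ... | true  = cong (1 +_) (length-filter≡∑ P? xs)
  ... | false = length-filter≡∑ P? xs

module _ {A B : Set} where

  ∑-map : ∀ (g : A → B) xs f → ∑ (map g xs) f ≡ ∑[ x ∈ xs ] f (g x)
  ∑-map g []       f = refl
  ∑-map g (x ∷ xs) f = cong (f (g x) +_) (∑-map g xs f)

  ∑-concatMap : ∀ (g : A → List B) xs f → ∑ (concatMap g xs) f ≡ ∑[ x ∈ xs ] ∑ (g x) f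
  ∑-concatMap g []       f = refl
  ∑-concatMap g (x ∷ xs) f =
    trans (∑-++ (g x) (concatMap g xs) f) (cong (∑ (g x) f +_) (∑-concatMap g xs f))

  ∑-comm : ∀ xs ys (f : A → B → ℕ) → ∑[ x ∈ xs ] ∑[ y ∈ ys ] f x y ≡ ∑[ y ∈ ys ] ∑[ x ∈ xs ] f x y
  ∑-comm []       ys f = sym (∑-zero ys)
  ∑-comm (x ∷ xs) ys f = trans (cong (∑ ys (f x) +_) (∑-comm xs ys f)) (sym (∑-+ ys (f x) _))

∑-concatMap-map : ∀ {A B C : Set} (g : A → B → C) (bs : A → List B) xs f →
                  ∑ (concatMap (λ x → map (g x) (bs x)) xs) f ≡ ∑[ x ∈ xs ] ∑[ y ∈ bs x ] f (g x y)
∑-concatMap-map g bs xs f = trans (∑-concatMap _ xs f) (∑-cong xs (λ x → ∑-map (g x) (bs x) f))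

∑-allFin-const : ∀ m c → ∑[ _ ∈ allFin m ] c ≡ m * c
∑-allFin-const m c = trans (∑-const (allFin m) c) (cong (_* c) (length-tabulate {n = m} id))

∑-allFin-suc : ∀ {m} (f : Fin (suc m) → ℕ) → ∑ (allFin (suc m)) f ≡ f zero + ∑[ i ∈ allFin m ] f (suc i)
∑-allFin-suc {m} f =
  cong (f zero +_) (trans (cong (λ is → ∑ is f) (sym (map-tabulate id suc))) (∑-map suc (allFin m) f))

∑-≟ : ∀ {m} (j : Fin m) → ∑[ i ∈ allFin m ] [ i ≟ j ] ≡ 1
∑-≟ {suc m} zero    = trans (∑-allFin-suc {m} (λ i → [ i ≟ zero ])) (cong (1 +_) (∑-zero (allFin m)))
∑-≟ {suc m} (suc j) = trans (∑-allFin-suc {m} (λ i → [ i ≟ suc j ])) (∑-≟ j)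

module _ (H : FiniteGroup) where
  open FiniteGroup H
  open IsGroup isGroup using (_\\_; _//_)

  private
    n : ℕ
    n = order

    elems : List (Fin n)
    elems = allFin n

    group : Group _ _
    group = record { isGroup = isGroup }

    open GroupProperties group using (x≈z//y; y≈x\\z; \\-leftDividesˡ; //-rightDividesˡ)

    Ω : (k : ℕ) → List (Fin k → Fin n × Fin n)
    Ω = sampleSpace H

    s : ∀ {k} → (Fin k → Fin n × Fin n) → Vec Bool k → Fin n
    s {k} = sVec H k

  δ : Fin n → Fin n → ℕ
  δ g a = [ g ≟ a ]

  δ-∙ˡ : ∀ g A a → δ (g ∙ A) a ≡ δ A (g \\ a)
  δ-∙ˡ g A a = []-cong {d = g ∙ A ≟ a} {e = A ≟ g \\ a}
    (y≈x\\z g A a) (λ A≡g\\a → trans (cong (g ∙_) A≡g\\a) (\\-leftDividesˡ g a))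

  δ-∙ʳ : ∀ g A a → δ (g ∙ A) a ≡ δ g (a // A)
  δ-∙ʳ g A a = []-cong {d = g ∙ A ≟ a} {e = g ≟ a // A}
    (x≈z//y g A a) (λ g≡a//A → trans (cong (_∙ A) g≡a//A) (//-rightDividesˡ A a))

  ∑-δ-∙ : ∀ A a → ∑[ g ∈ elems ] δ (g ∙ A) a ≡ 1
  ∑-δ-∙ A a = trans (∑-cong elems (λ g → δ-∙ʳ g A a)) (∑-≟ (a // A))

  ∑-δ-∙-* : ∀ A a m → ∑[ g ∈ elems ] (δ (g ∙ A) a * m) ≡ m
  ∑-δ-∙-* A a m = trans (∑-*ʳ elems m _) (trans (cong (_* m) (∑-δ-∙ A a)) (*-identityˡ m))

  ∑∑-δ-∙ : ∀ A a B b → ∑[ g ∈ elems ] ∑[ h ∈ elems ] (δ (g ∙ A) a * δ (h ∙ B) b) ≡ 1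
  ∑∑-δ-∙ A a B b = begin
    ∑[ g ∈ elems ] ∑[ h ∈ elems ] (δ (g ∙ A) a * δ (h ∙ B) b)
      ≡⟨ ∑-cong elems (λ g → ∑-*ˡ elems (δ (g ∙ A) a) _) ⟩
    ∑[ g ∈ elems ] (δ (g ∙ A) a * ∑[ h ∈ elems ] δ (h ∙ B) b)
      ≡⟨ ∑-cong elems (λ g → trans (cong (δ (g ∙ A) a *_) (∑-δ-∙ B b)) (*-identityʳ _)) ⟩
    ∑[ g ∈ elems ] δ (g ∙ A) a
      ≡⟨ ∑-δ-∙ A a ⟩
    1 ∎

  ∑-pick : ∀ {x₀ y₀} → x₀ ≢ y₀ → (f : Fin n → Fin n → ℕ) →
           ∑[ g ∈ elems ] ∑[ h ∈ elems ] f (pick H (g , h) x₀) (pick H (g , h) y₀)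
           ≡ ∑[ g ∈ elems ] ∑[ h ∈ elems ] f g h
  ∑-pick {false} {false} x₀≢y₀ f = contradiction refl x₀≢y₀
  ∑-pick {false} {true}  x₀≢y₀ f = refl
  ∑-pick {true}  {false} x₀≢y₀ f = ∑-comm elems elems (λ h g → f g h)
  ∑-pick {true}  {true}  x₀≢y₀ f = contradiction refl x₀≢y₀

  ∑-Ω-suc : ∀ k f → ∑ (Ω (suc k)) f ≡ ∑[ g ∈ elems ] ∑[ h ∈ elems ] ∑[ u ∈ Ω k ] f (cons (g , h) u)
  ∑-Ω-suc k f =
    trans (∑-concatMap-map cons (λ _ → Ω k) (concatMap (λ g → map (g ,_) elems) elems) f)
          (∑-concatMap-map _,_ (λ _ → elems) elems _)

  length-Ω-suc : ∀ k → length (Ω (suc k)) ≡ ∑[ _ ∈ elems ] ∑[ _ ∈ elems ] length (Ω k)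
  length-Ω-suc k = begin
    length (Ω (suc k))                          ≡⟨ length≡∑1 (Ω (suc k)) ⟩
    ∑[ _ ∈ Ω (suc k) ] 1                        ≡⟨ ∑-Ω-suc k _ ⟩
    ∑[ _ ∈ elems ] ∑[ _ ∈ elems ] ∑[ _ ∈ Ω k ] 1
      ≡⟨ ∑-cong elems (λ _ → ∑-cong elems (λ _ → sym (length≡∑1 (Ω k)))) ⟩
    ∑[ _ ∈ elems ] ∑[ _ ∈ elems ] length (Ω k)  ∎

  ∑∑-uniform : ∀ {k} m (f : Fin n → Fin n → ℕ) → (∀ g h → f g h * m ≡ length (Ω k)) →
               (∑[ g ∈ elems ] ∑[ h ∈ elems ] f g h) * m ≡ length (Ω (suc k))
  ∑∑-uniform {k} m f uniform = begin
    (∑[ g ∈ elems ] ∑[ h ∈ elems ] f g h) * m    ≡⟨ sym (∑-*ʳ elems m _) ⟩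
    ∑[ g ∈ elems ] ((∑[ h ∈ elems ] f g h) * m)  ≡⟨ ∑-cong elems (λ g → sym (∑-*ʳ elems m (f g))) ⟩
    ∑[ g ∈ elems ] ∑[ h ∈ elems ] (f g h * m)    ≡⟨ ∑-cong elems (λ g → ∑-cong elems (uniform g)) ⟩
    ∑[ _ ∈ elems ] ∑[ _ ∈ elems ] length (Ω k)   ≡⟨ sym (length-Ω-suc k) ⟩
    length (Ω (suc k))                           ∎

  count₂ : ∀ {k} → Vec Bool k → Fin n → Vec Bool k → Fin n → ℕ
  count₂ {k} x a y b = ∑[ u ∈ Ω k ] (δ (s u x) a * δ (s u y) b)

  count₃ : ∀ {k} → Vec Bool k → Fin n → Vec Bool k → Fin n → Vec Bool k → Fin n → ℕ
  count₃ {k} x a y b z c = ∑[ u ∈ Ω k ] (δ (s u x) a * (δ (s u y) b * δ (s u z) c))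

  count₂-suc : ∀ {k} x₀ (x : Vec Bool k) a y₀ y b →
               count₂ (x₀ ∷ x) a (y₀ ∷ y) b
               ≡ ∑[ g ∈ elems ] ∑[ h ∈ elems ] count₂ x (pick H (g , h) x₀ \\ a) y (pick H (g , h) y₀ \\ b)
  count₂-suc {k} x₀ x a y₀ y b =
    trans (∑-Ω-suc k _) (∑-cong elems λ g → ∑-cong elems λ h → ∑-cong (Ω k) λ u →
      cong₂ _*_ (δ-∙ˡ (pick H (g , h) x₀) (s u x) a) (δ-∙ˡ (pick H (g , h) y₀) (s u y) b))

  count₃-suc : ∀ {k} x₀ (x : Vec Bool k) a y₀ y b z₀ z c →
               count₃ (x₀ ∷ x) a (y₀ ∷ y) b (z₀ ∷ z) c
               ≡ ∑[ g ∈ elems ] ∑[ h ∈ elems ]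
                   count₃ x (pick H (g , h) x₀ \\ a) y (pick H (g , h) y₀ \\ b) z (pick H (g , h) z₀ \\ c)
  count₃-suc {k} x₀ x a y₀ y b z₀ z c =
    trans (∑-Ω-suc k _) (∑-cong elems λ g → ∑-cong elems λ h → ∑-cong (Ω k) λ u →
      cong₂ _*_ (δ-∙ˡ (pick H (g , h) x₀) (s u x) a)
                (cong₂ _*_ (δ-∙ˡ (pick H (g , h) y₀) (s u y) b) (δ-∙ˡ (pick H (g , h) z₀) (s u z) c)))

  count₃-swap₁₂ : ∀ {k} (x : Vec Bool k) a y b z c → count₃ x a y b z c ≡ count₃ y b x a z c
  count₃-swap₁₂ {k} x a y b z c = ∑-cong (Ω k) λ u → *-leftComm (δ (s u x) a) (δ (s u y) b) (δ (s u z) c)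

  count₃-swap₂₃ : ∀ {k} (x : Vec Bool k) a y b z c → count₃ x a y b z c ≡ count₃ x a z c y b
  count₃-swap₂₃ {k} x a y b z c = ∑-cong (Ω k) λ u → cong (δ (s u x) a *_) (*-comm (δ (s u y) b) (δ (s u z) c))

  count₂-sameTail : ∀ {k x₀ y₀} → x₀ ≢ y₀ → ∀ (w : Vec Bool k) a b →
                    count₂ (x₀ ∷ w) a (y₀ ∷ w) b ≡ length (Ω k)
  count₂-sameTail {k} {x₀} {y₀} x₀≢y₀ w a b = begin
    count₂ (x₀ ∷ w) a (y₀ ∷ w) b
      ≡⟨ ∑-Ω-suc k _ ⟩
    ∑[ g ∈ elems ] ∑[ h ∈ elems ] ∑[ u ∈ Ω k ]
      (δ (pick H (g , h) x₀ ∙ s u w) a * δ (pick H (g , h) y₀ ∙ s u w) b)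
      ≡⟨ ∑-pick x₀≢y₀ (λ g h → ∑[ u ∈ Ω k ] (δ (g ∙ s u w) a * δ (h ∙ s u w) b)) ⟩
    ∑[ g ∈ elems ] ∑[ h ∈ elems ] ∑[ u ∈ Ω k ] (δ (g ∙ s u w) a * δ (h ∙ s u w) b)
      ≡⟨ ∑-cong elems (λ g → ∑-comm elems (Ω k) _) ⟩
    ∑[ g ∈ elems ] ∑[ u ∈ Ω k ] ∑[ h ∈ elems ] (δ (g ∙ s u w) a * δ (h ∙ s u w) b)
      ≡⟨ ∑-comm elems (Ω k) _ ⟩
    ∑[ u ∈ Ω k ] ∑[ g ∈ elems ] ∑[ h ∈ elems ] (δ (g ∙ s u w) a * δ (h ∙ s u w) b)
      ≡⟨ ∑-cong (Ω k) (λ u → ∑∑-δ-∙ (s u w) a (s u w) b) ⟩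
    ∑[ _ ∈ Ω k ] 1
      ≡⟨ sym (length≡∑1 (Ω k)) ⟩
    length (Ω k) ∎

  count₂-uniform : ∀ {k} (x y : Vec Bool k) → x ≢ y → ∀ a b → count₂ x a y b * n ^ 2 ≡ length (Ω k)
  count₂-uniform []        []        x≢y a b = contradiction refl x≢y
  count₂-uniform {suc k} (x₀ ∷ x) (y₀ ∷ y) x≢y a b with x ≟ᵛ y
  ... | no x≢y′ =
    trans (cong (_* n ^ 2) (count₂-suc x₀ x a y₀ y b))
          (∑∑-uniform (n ^ 2) _ λ g h → count₂-uniform x y x≢y′ _ _)
  ... | yes refl = begin
    count₂ (x₀ ∷ x) a (y₀ ∷ x) b * n ^ 2        ≡⟨ cong (_* n ^ 2) (count₂-sameTail (x≢y ∘ cong (_∷ x)) x a b) ⟩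
    length (Ω k) * n ^ 2                        ≡⟨ solve 2 (λ n L → L :* n :^ 2 := n :* (n :* L)) refl n _ ⟩
    n * (n * length (Ω k))                      ≡⟨ sym (∑-allFin-const n _) ⟩
    ∑[ _ ∈ elems ] (n * length (Ω k))           ≡⟨ sym (∑-cong elems (λ _ → ∑-allFin-const n _)) ⟩
    ∑[ _ ∈ elems ] ∑[ _ ∈ elems ] length (Ω k)  ≡⟨ sym (length-Ω-suc k) ⟩
    length (Ω (suc k))                          ∎

  count₃-collapse : ∀ {k x₀ y₀} → x₀ ≢ y₀ → ∀ (w z : Vec Bool k) a b c →
                    count₃ (x₀ ∷ w) a (y₀ ∷ w) b (x₀ ∷ z) c ≡ ∑[ g ∈ elems ] count₂ w (g \\ a) z (g \\ c)
  count₃-collapse {k} {x₀} {y₀} x₀≢y₀ w z a b c = begin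
    count₃ (x₀ ∷ w) a (y₀ ∷ w) b (x₀ ∷ z) c
      ≡⟨ ∑-Ω-suc k _ ⟩
    ∑[ g ∈ elems ] ∑[ h ∈ elems ] ∑[ u ∈ Ω k ]
      (δ (pick H (g , h) x₀ ∙ s u w) a * (δ (pick H (g , h) y₀ ∙ s u w) b * δ (pick H (g , h) x₀ ∙ s u z) c))
      ≡⟨ ∑-pick x₀≢y₀ (λ g h → ∑[ u ∈ Ω k ] (δ (g ∙ s u w) a * (δ (h ∙ s u w) b * δ (g ∙ s u z) c))) ⟩
    ∑[ g ∈ elems ] ∑[ h ∈ elems ] ∑[ u ∈ Ω k ] (δ (g ∙ s u w) a * (δ (h ∙ s u w) b * δ (g ∙ s u z) c))
      ≡⟨ ∑-cong elems (λ g → ∑-comm elems (Ω k) _) ⟩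
    ∑[ g ∈ elems ] ∑[ u ∈ Ω k ] ∑[ h ∈ elems ] (δ (g ∙ s u w) a * (δ (h ∙ s u w) b * δ (g ∙ s u z) c))
      ≡⟨ ∑-cong elems (λ g → ∑-cong (Ω k) (λ u → sum-over-h g u)) ⟩
    ∑[ g ∈ elems ] ∑[ u ∈ Ω k ] (δ (g ∙ s u w) a * δ (g ∙ s u z) c)
      ≡⟨ ∑-cong elems (λ g → ∑-cong (Ω k) (λ u → cong₂ _*_ (δ-∙ˡ g (s u w) a) (δ-∙ˡ g (s u z) c))) ⟩
    ∑[ g ∈ elems ] count₂ w (g \\ a) z (g \\ c) ∎
    where
    sum-over-h : ∀ g u → ∑[ h ∈ elems ] (δ (g ∙ s u w) a * (δ (h ∙ s u w) b * δ (g ∙ s u z) c))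
                         ≡ δ (g ∙ s u w) a * δ (g ∙ s u z) c
    sum-over-h g u = trans (∑-cong elems (λ h → *-leftComm (δ (g ∙ s u w) a) (δ (h ∙ s u w) b) _))
                           (∑-δ-∙-* (s u w) b _)

  count₃-uniform-collapse : ∀ {k x₀ y₀} → x₀ ≢ y₀ → ∀ (w z : Vec Bool k) → w ≢ z → ∀ a b c →
                            count₃ (x₀ ∷ w) a (y₀ ∷ w) b (x₀ ∷ z) c * n ^ 3 ≡ length (Ω (suc k))
  count₃-uniform-collapse {k} {x₀} {y₀} x₀≢y₀ w z w≢z a b c = begin
    count₃ (x₀ ∷ w) a (y₀ ∷ w) b (x₀ ∷ z) c * n ^ 3
      ≡⟨ cong (_* n ^ 3) (count₃-collapse x₀≢y₀ w z a b c) ⟩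
    ∑ elems pairCount * n ^ 3
      ≡⟨ solve 2 (λ n X → X :* n :^ 3 := n :* X :* n :^ 2) refl n _ ⟩
    n * ∑ elems pairCount * n ^ 2
      ≡⟨ cong (_* n ^ 2) (sym (∑-*ˡ elems n pairCount)) ⟩
    ∑[ g ∈ elems ] (n * pairCount g) * n ^ 2
      ≡⟨ cong (_* n ^ 2) (∑-cong elems (λ g → sym (∑-allFin-const n (pairCount g)))) ⟩
    ∑[ g ∈ elems ] ∑[ _ ∈ elems ] pairCount g * n ^ 2
      ≡⟨ ∑∑-uniform (n ^ 2) (λ g _ → pairCount g) (λ g _ → count₂-uniform w z w≢z _ _) ⟩
    length (Ω (suc k)) ∎
    where
    pairCount : Fin n → ℕ
    pairCount g = count₂ w (g \\ a) z (g \\ c)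

  count₃-uniform-sameTail : ∀ {k x₀ y₀ z₀} (w z : Vec Bool k) →
                            x₀ ∷ w ≢ y₀ ∷ w → x₀ ∷ w ≢ z₀ ∷ z → y₀ ∷ w ≢ z₀ ∷ z → ∀ a b c →
                            count₃ (x₀ ∷ w) a (y₀ ∷ w) b (z₀ ∷ z) c * n ^ 3 ≡ length (Ω (suc k))
  count₃-uniform-sameTail {x₀ = x₀} {y₀} {z₀} w z x≢y x≢z y≢z a b c with z₀ ≟ᵇ x₀
  ... | yes refl = count₃-uniform-collapse (x≢y ∘ cong (_∷ w)) w z (x≢z ∘ cong (x₀ ∷_)) a b c
  ... | no z₀≢x₀ with ≢-≢⇒≡ (x≢y ∘ cong (_∷ w) ∘ sym) z₀≢x₀
  ...   | refl = trans (cong (_* n ^ 3) (count₃-swap₁₂ (x₀ ∷ w) a (z₀ ∷ w) b (z₀ ∷ z) c))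
                       (count₃-uniform-collapse z₀≢x₀ w z (y≢z ∘ cong (z₀ ∷_)) b a c)

  count₃-uniform : ∀ {k} (x y z : Vec Bool k) → x ≢ y → x ≢ z → y ≢ z → ∀ a b c →
                   count₃ x a y b z c * n ^ 3 ≡ length (Ω k)
  count₃-uniform [] [] [] x≢y x≢z y≢z a b c = contradiction refl x≢y
  count₃-uniform (x₀ ∷ x) (y₀ ∷ y) (z₀ ∷ z) x≢y x≢z y≢z a b c with x ≟ᵛ y | x ≟ᵛ z | y ≟ᵛ z
  ... | yes refl | _ | _ = count₃-uniform-sameTail x z x≢y x≢z y≢z a b c
  ... | _ | yes refl | _ =
    trans (cong (_* n ^ 3) (count₃-swap₂₃ (x₀ ∷ x) a (y₀ ∷ y) b (z₀ ∷ x) c))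
          (count₃-uniform-sameTail x y x≢z x≢y (≢-sym y≢z) a c b)
  ... | _ | _ | yes refl =
    trans (cong (_* n ^ 3) (trans (count₃-swap₁₂ (x₀ ∷ x) a (y₀ ∷ y) b (z₀ ∷ y) c)
                                  (count₃-swap₂₃ (y₀ ∷ y) b (x₀ ∷ x) a (z₀ ∷ y) c)))
          (count₃-uniform-sameTail y x y≢z (≢-sym x≢y) (≢-sym x≢z) b c a)
  ... | no x≢y′ | no x≢z′ | no y≢z′ =
    trans (cong (_* n ^ 3) (count₃-suc x₀ x a y₀ y b z₀ z c))
          (∑∑-uniform (n ^ 3) _ λ g h → count₃-uniform x y z x≢y′ x≢z′ y≢z′ _ _ _)

claim4p2 : (H : FiniteGroup) (k : ℕ) → k ≥ 2 →
    ThreeUniform (FiniteGroup.order H) (sampleSpace H k) (sVec H k)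
claim4p2 H k _ x y z x≢y x≢z y≢z a b c = begin
  length (filter P? (Ω k)) * n ^ 3  ≡⟨ cong (_* n ^ 3) (length-filter≡∑ P? (Ω k)) ⟩
  ∑[ u ∈ Ω k ] [ P? u ] * n ^ 3     ≡⟨ cong (_* n ^ 3) (∑-cong (Ω k) [P?]≡δ) ⟩
  count₃ H x a y b z c * n ^ 3      ≡⟨ count₃-uniform H x y z x≢y x≢z y≢z a b c ⟩
  length (Ω k)                      ∎
  where
  open FiniteGroup H using () renaming (order to n)

  Ω : (k : ℕ) → List (Fin k → Fin n × Fin n)
  Ω = sampleSpace H

  s : (Fin k → Fin n × Fin n) → Vec Bool k → Fin n
  s = sVec H k

  P? : ∀ u → Dec (s u x ≡ a × s u y ≡ b × s u z ≡ c)
  P? u = (s u x ≟ a) ×-dec ((s u y ≟ b) ×-dec (s u z ≟ c))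

  [P?]≡δ : ∀ u → [ P? u ] ≡ δ H (s u x) a * (δ H (s u y) b * δ H (s u z) c)
  [P?]≡δ u = trans ([×-dec] (s u x ≟ a) ((s u y ≟ b) ×-dec (s u z ≟ c)))
                   (cong (δ H (s u x) a *_) ([×-dec] (s u y ≟ b) (s u z ≟ c)))
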